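{- Let $\beta(n)=n^{\alpha(n)}$ with a nondecreasing, e-consistent function $\alpha:\mathbb{N}\to\mathbb{N}$ such that $1\le_a\alpha(n)\le_a\log(n)$. Then $\mathrm{It}(\beta)\le_a\{n^{(\alpha(n))^l}:l\in\mathbb{N}\}$ and $\{n^{(\alpha(n))^l}:l\in\mathbb{N}\}\le_a\mathrm{It}(\beta)$. If $\beta_i(n)=n^{\alpha_i(n)}$ ($i=1,2$) with nondecreasing, e-consistent $\alpha_i$ satisfying $1\le_a\alpha_i(n)\le_a\log(n)$, then $\beta_1\le_{\mathrm{it}}\beta_2$ iff $\alpha_1\le_{\mathrm{pow}}\alpha_2$, and $\beta_1\prec_{\mathrm{it}}\beta_2$ iff $\alpha_1\prec_{\mathrm{pow}}\alpha_2$; moreover $2\le_a\alpha_1\ll_{\mathrm{pow}}\alpha_2$ implies $\beta_1\prec_{\mathrm{it}}\beta_2$.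
   Context: $\log(n)=\lceil\log_2n\rceil$ for $n\ge2$, $\log(0)=\log(1)=1$. $f\le_a g$: $f(n)\le g(n)$ for almost all $n$; for sets of functions, $B_1\le_a B_2$: each element of $B_1$ is $\le_a$ some element of $B_2$. $f^k(n)=(f(n))^k$; $\mathrm{It}(\beta)=\{\beta^{\langle m\rangle}:m\ge1\}$ ($m$-fold iterates). $\beta_1\le_{\mathrm{it}}\beta_2$ iff $\mathrm{It}(\beta_1)\le_a\mathrm{It}(\beta_2)$; $\beta_1\prec_{\mathrm{it}}\beta_2$ iff $\beta_1\le_{\mathrm{it}}\beta_2$ but not $\beta_2\le_{\mathrm{it}}\beta_1$. $\alpha_1\le_{\mathrm{pow}}\alpha_2$ iff for each $k\in\mathbb{N}$ there is $l\in\mathbb{N}$ with $\alpha_1^k\le_a\alpha_2^l$; $\alpha_1\prec_{\mathrm{pow}}\alpha_2$ iff $\alpha_1\le_{\mathrm{pow}}\alpha_2$ but not $\alpha_2\le_{\mathrm{pow}}\alpha_1$; $\alpha_1\ll_{\mathrm{pow}}\alpha_2$ iff $\alpha_1^k\le_a\alpha_2$ for all $k$. $\alpha$ is e-consistent if for every $k\in\mathbb{N}$ there is $l\in\mathbb{N}$ with $\alpha(n^{(\log n)^k})\le(\alpha(n))^l$ for almost all $n$. -}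

module Defs where

open import Data.Nat using (ℕ; zero; suc; _+_; _*_; _^_; _≤_; _<_)
open import Data.Nat.Logarithm using (⌈log₂_⌉)
open import Data.Product using (Σ; ∃; _×_)
open import Relation.Nullary using (¬_)

log : ℕ → ℕ
log zero = 1
log (suc zero) = 1
log (suc (suc n)) = ⌈log₂ (suc (suc n)) ⌉

AlmostAll : (ℕ → Set) → Set
AlmostAll P = ∃ λ N → ∀ n → N ≤ n → P n

_≤ₐ_ : (ℕ → ℕ) → (ℕ → ℕ) → Set
f ≤ₐ g = AlmostAll λ n → f n ≤ g n

-- sets of functions as ℕ-indexed families; B₁ ≤_a B₂
-- (each element of B₁ is ≤_a some element of B₂)
_≤ₐˢ_ : (ℕ → ℕ → ℕ) → (ℕ → ℕ → ℕ) → Set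
B₁ ≤ₐˢ B₂ = ∀ i → ∃ λ j → B₁ i ≤ₐ B₂ j

iter : ℕ → (ℕ → ℕ) → ℕ → ℕ
iter zero f n = n
iter (suc m) f n = f (iter m f n)

-- It(β) = { β^⟨m⟩ : m ≥ 1 }, indexed by i ↦ β^⟨i+1⟩
It : (ℕ → ℕ) → ℕ → ℕ → ℕ
It β i = iter (suc i) β

PowSet : (ℕ → ℕ) → ℕ → ℕ → ℕ
PowSet α l n = n ^ (α n ^ l)

_≤it_ : (ℕ → ℕ) → (ℕ → ℕ) → Set
β₁ ≤it β₂ = It β₁ ≤ₐˢ It β₂

_≺it_ : (ℕ → ℕ) → (ℕ → ℕ) → Set
β₁ ≺it β₂ = β₁ ≤it β₂ × ¬ (β₂ ≤it β₁)

_^ᶠ_ : (ℕ → ℕ) → ℕ → ℕ → ℕ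
(f ^ᶠ k) n = f n ^ k

_≤pow_ : (ℕ → ℕ) → (ℕ → ℕ) → Set
α₁ ≤pow α₂ = ∀ k → ∃ λ l → (α₁ ^ᶠ k) ≤ₐ (α₂ ^ᶠ l)

_≺pow_ : (ℕ → ℕ) → (ℕ → ℕ) → Set
α₁ ≺pow α₂ = α₁ ≤pow α₂ × ¬ (α₂ ≤pow α₁)

_≪pow_ : (ℕ → ℕ) → (ℕ → ℕ) → Set
α₁ ≪pow α₂ = ∀ k → (α₁ ^ᶠ k) ≤ₐ α₂

NonDecreasing : (ℕ → ℕ) → Set
NonDecreasing α = ∀ {m n} → m ≤ n → α m ≤ α n

EConsistent : (ℕ → ℕ) → Set
EConsistent α = ∀ k → ∃ λ l → AlmostAll λ n → α (n ^ (log n ^ k)) ≤ α n ^ l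

Admissible : (ℕ → ℕ) → Set
Admissible α = NonDecreasing α × EConsistent α × ((λ _ → 1) ≤ₐ α) × (α ≤ₐ log)

βof : (ℕ → ℕ) → ℕ → ℕ
βof α n = n ^ α n

-- From below: since α is nondecreasing and every iterate is at least n, each
-- further application of β raises the exponent by a factor α n. From above: if
-- x ≤ n ^ (α n ^ c), then α ≤ log and e-consistency bound α x by a power of α n,
-- so β x is again a tower of this shape. Hence It(β) and {n ^ (α n ^ l)} bound
-- each other, and comparing towers over a base n ≥ 2 means comparing their
-- exponents, which is exactly the order ≤pow.
module Submission where

open import Defs
open import Data.Nat using (ℕ; zero; suc; _+_; _*_; _^_; _≤_; _<_; _⊔_; z≤n; >-nonZero)
open import Data.Nat.Properties
open import Data.Product using (_×_; _,_; ∃)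
open import Data.Product.Function.NonDependent.Propositional using (_×-⇔_)
open import Function.Bundles using (_⇔_; mk⇔; module Equivalence)
open import Function.Related.TypeIsomorphisms using (¬-cong-⇔)
open import Relation.Binary.PropositionalEquality using (_≡_; cong; sym; module ≡-Reasoning)
open import Relation.Nullary using (¬_)

open Equivalence using (to; from)

private
  variable
    P Q : ℕ → Set
    f g h : ℕ → ℕ
    B₁ B₂ B₃ : ℕ → ℕ → ℕ

infixr 2 _×ₐ_

_×ₐ_ : AlmostAll P → AlmostAll Q → AlmostAll (λ n → P n × Q n)
(M , p) ×ₐ (N , q) = M ⊔ N , λ n M⊔N≤n →
  p n (≤-trans (m≤m⊔n M N) M⊔N≤n) , q n (≤-trans (m≤n⊔m M N) M⊔N≤n)

almostAll-≥ : ∀ N → AlmostAll (N ≤_)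
almostAll-≥ N = N , λ _ N≤n → N≤n

almostAll-map : (∀ {n} → P n → Q n) → AlmostAll P → AlmostAll Q
almostAll-map P⇒Q (N , p) = N , λ n N≤n → P⇒Q (p n N≤n)

almostAll-∃ : AlmostAll P → ∃ P
almostAll-∃ (N , p) = N , p N ≤-refl

≤ₐ-trans : f ≤ₐ g → g ≤ₐ h → f ≤ₐ h
≤ₐ-trans f≤g g≤h = almostAll-map (λ (p , q) → ≤-trans p q) (f≤g ×ₐ g≤h)

≤ₐˢ-trans : B₁ ≤ₐˢ B₂ → B₂ ≤ₐˢ B₃ → B₁ ≤ₐˢ B₃
≤ₐˢ-trans B₁≤B₂ B₂≤B₃ i with B₁≤B₂ i
... | j , Bi≤Bj with B₂≤B₃ j
... | k , Bj≤Bk = k , ≤ₐ-trans Bi≤Bj Bj≤Bk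

^-monoʳ-≤-pos : ∀ m {a b} → 1 ≤ m → a ≤ b → m ^ a ≤ m ^ b
^-monoʳ-≤-pos m 1≤m = ^-monoʳ-≤ m {{>-nonZero 1≤m}}

^-cancelʳ-≤ : ∀ m {a b} → 1 < m → m ^ a ≤ m ^ b → a ≤ b
^-cancelʳ-≤ m 1<m mᵃ≤mᵇ = ≮⇒≥ λ b<a → <⇒≱ (^-monoʳ-< m 1<m b<a) mᵃ≤mᵇ

1≤^ : ∀ m n → 1 ≤ m → 1 ≤ m ^ n
1≤^ m n 1≤m = ^-monoʳ-≤-pos m 1≤m (z≤n {n})

PowSet-suc : ∀ α l n → PowSet α (suc l) n ≡ PowSet α l n ^ α n
PowSet-suc α l n = begin
  n ^ (α n * α n ^ l) ≡⟨ cong (n ^_) (*-comm (α n) (α n ^ l)) ⟩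
  n ^ (α n ^ l * α n) ≡⟨ sym (^-*-assoc n (α n ^ l) (α n)) ⟩
  (n ^ (α n ^ l)) ^ α n ∎
  where open ≡-Reasoning

PowSet-+ : ∀ α c l n → PowSet α (c + l) n ≡ PowSet α c n ^ (α n ^ l)
PowSet-+ α c l n = begin
  n ^ (α n ^ (c + l))         ≡⟨ cong (n ^_) (^-distribˡ-+-* (α n) c l) ⟩
  n ^ (α n ^ c * α n ^ l)     ≡⟨ sym (^-*-assoc n (α n ^ c) (α n ^ l)) ⟩
  (n ^ (α n ^ c)) ^ (α n ^ l) ∎
  where open ≡-Reasoning

PowSet≤iter : ∀ α → NonDecreasing α → ∀ {n} → 1 ≤ n → 1 ≤ α n →
              ∀ m → PowSet α m n ≤ iter m (βof α) n
PowSet≤iter α mono {n} 1≤n 1≤αn zero = ≤-reflexive (^-identityʳ n)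
PowSet≤iter α mono {n} 1≤n 1≤αn (suc m) = begin
  PowSet α (suc m) n     ≡⟨ PowSet-suc α m n ⟩
  PowSet α m n ^ α n     ≤⟨ ^-monoˡ-≤ (α n) ih ⟩
  x ^ α n                ≤⟨ ^-monoʳ-≤-pos x (≤-trans 1≤n n≤x) (mono n≤x) ⟩
  x ^ α x                ∎
  where
  open ≤-Reasoning
  x = iter m (βof α) n
  ih : PowSet α m n ≤ x
  ih = PowSet≤iter α mono 1≤n 1≤αn m
  n≤x : n ≤ x
  n≤x = ≤-trans (≤-trans (≤-reflexive (sym (^-identityʳ n)))
                         (^-monoʳ-≤-pos n 1≤n (1≤^ (α n) m 1≤αn))) ih

iter≤PowSet : ∀ α → NonDecreasing α → EConsistent α → α ≤ₐ log →
              ∀ j → ∃ λ c → iter j (βof α) ≤ₐ PowSet α c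
iter≤PowSet α mono econ α≤log zero = 0 , 0 , λ n _ → ≤-reflexive (sym (^-identityʳ n))
iter≤PowSet α mono econ α≤log (suc j) with iter≤PowSet α mono econ α≤log j
... | c , iterⱼ≤ with econ c
... | l , αlog≤ =
  c + l , almostAll-map step (iterⱼ≤ ×ₐ αlog≤ ×ₐ α≤log ×ₐ almostAll-≥ 1)
  where
  step : ∀ {n} → let x = iter j (βof α) n in
         x ≤ PowSet α c n × α (n ^ (log n ^ c)) ≤ α n ^ l × α n ≤ log n × 1 ≤ n →
         x ^ α x ≤ PowSet α (c + l) n
  step {n} (x≤ , αlog≤αⁿ , αn≤log , 1≤n) = begin
    x ^ α x                   ≤⟨ ^-monoˡ-≤ (α x) x≤ ⟩
    PowSet α c n ^ α x        ≤⟨ ^-monoʳ-≤-pos (PowSet α c n) (1≤^ n (α n ^ c) 1≤n) αx≤ ⟩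
    PowSet α c n ^ (α n ^ l)  ≡⟨ sym (PowSet-+ α c l n) ⟩
    PowSet α (c + l) n        ∎
    where
    open ≤-Reasoning
    x = iter j (βof α) n
    αx≤ : α x ≤ α n ^ l
    αx≤ = ≤-trans (mono (≤-trans x≤ (^-monoʳ-≤-pos n 1≤n (^-monoˡ-≤ c αn≤log))))
                  αlog≤αⁿ

It≤ₐˢPowSet : ∀ α → NonDecreasing α → EConsistent α → α ≤ₐ log → It (βof α) ≤ₐˢ PowSet α
It≤ₐˢPowSet α mono econ α≤log i = iter≤PowSet α mono econ α≤log (suc i)

PowSet≤ₐˢIt : ∀ α → NonDecreasing α → (λ _ → 1) ≤ₐ α → PowSet α ≤ₐˢ It (βof α)
PowSet≤ₐˢIt α mono 1≤α l = l , almostAll-map step (1≤α ×ₐ almostAll-≥ 1)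
  where
  step : ∀ {n} → 1 ≤ α n × 1 ≤ n → PowSet α l n ≤ iter (suc l) (βof α) n
  step {n} (1≤αn , 1≤n) =
    ≤-trans (^-monoʳ-≤-pos n 1≤n (^-monoʳ-≤-pos (α n) 1≤αn (n≤1+n l)))
            (PowSet≤iter α mono 1≤n 1≤αn (suc l))

PowSet-≤ₐˢ⇔≤pow : ∀ α₁ α₂ → PowSet α₁ ≤ₐˢ PowSet α₂ ⇔ α₁ ≤pow α₂
PowSet-≤ₐˢ⇔≤pow α₁ α₂ = mk⇔ exponents towers
  where
  exponents : PowSet α₁ ≤ₐˢ PowSet α₂ → α₁ ≤pow α₂
  exponents P₁≤P₂ k with P₁≤P₂ k
  ... | l , towers≤ =
    l , almostAll-map (λ (mᵃ≤mᵇ , 2≤n) → ^-cancelʳ-≤ _ 2≤n mᵃ≤mᵇ) (towers≤ ×ₐ almostAll-≥ 2)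
  towers : α₁ ≤pow α₂ → PowSet α₁ ≤ₐˢ PowSet α₂
  towers α₁≤α₂ k with α₁≤α₂ k
  ... | l , exps≤ =
    l , almostAll-map (λ (a≤b , 1≤n) → ^-monoʳ-≤-pos _ 1≤n a≤b) (exps≤ ×ₐ almostAll-≥ 1)

It≤ₐˢ⇔PowSet≤ₐˢ : ∀ α₁ α₂ → Admissible α₁ → Admissible α₂ →
                   It (βof α₁) ≤ₐˢ It (βof α₂) ⇔ PowSet α₁ ≤ₐˢ PowSet α₂
It≤ₐˢ⇔PowSet≤ₐˢ α₁ α₂ (mono₁ , econ₁ , 1≤α₁ , α₁≤log) (mono₂ , econ₂ , 1≤α₂ , α₂≤log) = mk⇔
  (λ It≤It → ≤ₐˢ-trans (PowSet≤ₐˢIt α₁ mono₁ 1≤α₁)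
               (≤ₐˢ-trans It≤It (It≤ₐˢPowSet α₂ mono₂ econ₂ α₂≤log)))
  (λ P≤P → ≤ₐˢ-trans (It≤ₐˢPowSet α₁ mono₁ econ₁ α₁≤log)
             (≤ₐˢ-trans P≤P (PowSet≤ₐˢIt α₂ mono₂ 1≤α₂)))

≤it⇔≤pow : ∀ α₁ α₂ → Admissible α₁ → Admissible α₂ → (βof α₁ ≤it βof α₂) ⇔ (α₁ ≤pow α₂)
≤it⇔≤pow α₁ α₂ ad₁ ad₂ = mk⇔
  (λ β₁≤β₂ → to (PowSet-≤ₐˢ⇔≤pow α₁ α₂) (to (It≤ₐˢ⇔PowSet≤ₐˢ α₁ α₂ ad₁ ad₂) β₁≤β₂))
  (λ α₁≤α₂ → from (It≤ₐˢ⇔PowSet≤ₐˢ α₁ α₂ ad₁ ad₂) (from (PowSet-≤ₐˢ⇔≤pow α₁ α₂) α₁≤α₂))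

≺it⇔≺pow : ∀ α₁ α₂ → Admissible α₁ → Admissible α₂ → (βof α₁ ≺it βof α₂) ⇔ (α₁ ≺pow α₂)
≺it⇔≺pow α₁ α₂ ad₁ ad₂ = ≤it⇔≤pow α₁ α₂ ad₁ ad₂ ×-⇔ ¬-cong-⇔ (≤it⇔≤pow α₂ α₁ ad₂ ad₁)

≪pow⇒≤pow : ∀ α₁ α₂ → α₁ ≪pow α₂ → α₁ ≤pow α₂
≪pow⇒≤pow α₁ α₂ α₁≪α₂ k =
  1 , almostAll-map (λ {n} αᵏ≤α₂ → ≤-trans αᵏ≤α₂ (≤-reflexive (sym (^-identityʳ (α₂ n)))))
                    (α₁≪α₂ k)

≪pow⇒≱pow : ∀ α₁ α₂ → (λ _ → 2) ≤ₐ α₁ → α₁ ≪pow α₂ → ¬ (α₂ ≤pow α₁)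
≪pow⇒≱pow α₁ α₂ 2≤α₁ α₁≪α₂ α₂≤α₁ with α₂≤α₁ 1
... | l , α₂≤α₁ˡ with almostAll-∃ (α₂≤α₁ˡ ×ₐ α₁≪α₂ (suc l) ×ₐ 2≤α₁)
... | n , α₂ⁿ≤ , α₁ˡ⁺¹≤ , 2≤α₁n = <⇒≱ (^-monoʳ-< (α₁ n) 2≤α₁n (n<1+n l)) (begin
  α₁ n ^ suc l  ≤⟨ α₁ˡ⁺¹≤ ⟩
  α₂ n          ≡⟨ sym (^-identityʳ (α₂ n)) ⟩
  α₂ n ^ 1      ≤⟨ α₂ⁿ≤ ⟩
  α₁ n ^ l      ∎)
  where open ≤-Reasoning

lemma17 : (∀ α → Admissible α →
    It (βof α) ≤ₐˢ PowSet α × PowSet α ≤ₐˢ It (βof α))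
    × (∀ α₁ α₂ → Admissible α₁ → Admissible α₂ →
    ((βof α₁ ≤it βof α₂) ⇔ (α₁ ≤pow α₂))
    × ((βof α₁ ≺it βof α₂) ⇔ (α₁ ≺pow α₂))
    × ((λ _ → 2) ≤ₐ α₁ → α₁ ≪pow α₂ → βof α₁ ≺it βof α₂))
lemma17 =
  (λ α (mono , econ , 1≤α , α≤log) →
     It≤ₐˢPowSet α mono econ α≤log , PowSet≤ₐˢIt α mono 1≤α)
  , λ α₁ α₂ ad₁ ad₂ →
      ≤it⇔≤pow α₁ α₂ ad₁ ad₂
    , ≺it⇔≺pow α₁ α₂ ad₁ ad₂
    , λ 2≤α₁ α₁≪α₂ → from (≺it⇔≺pow α₁ α₂ ad₁ ad₂)
                       (≪pow⇒≤pow α₁ α₂ α₁≪α₂ , ≪pow⇒≱pow α₁ α₂ 2≤α₁ α₁≪α₂)
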